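{- Let $t\ge 2$ and $m\ge1$ be integers, let $P$ be a string of length $t-2$ over the alphabet $\{\mathtt{3},\mathtt{4},\mathtt{5},\mathtt{6}\}$ containing no Abelian square factor, and let $U_{2t}=\mathtt{0}\,P\,\mathtt{1}\,\mathtt{2}\,P^R\,\mathtt{0}$ (a string of length $2t$). Then the Abelian square factors of $(U_{2t})^m$ are exactly the following: (1) the even-length factors whose length is divisible by $4t$; and (2) the even-length factors whose center lies between two consecutive letters $\mathtt{0}$ and whose length is not of the form $(4q+2)t$ for an integer $q\ge0$.
   Context: $\mathtt{0},\dots,\mathtt{6}$ are seven distinct letters. $P^R$ denotes the reverse of $P$, and $(U)^m$ the concatenation of $m$ copies of $U$. Two strings $X,Y$ are Abelian-equivalent if $Y$ is a permutation of $X$. An Abelian square is a string $XY$ with $X,Y$ nonempty and Abelian-equivalent. A factor is a substring of consecutive letters; the center of an even-length factor $S[i-\ell+1..i+\ell]$ is between positions $i$ and $i+1$. -}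

module Defs where

open import Data.Nat using (ℕ; zero; suc; _+_; _*_; _∸_; _≤_; _<_)
open import Data.Fin using (Fin)
open import Data.List using (List; []; _∷_; _++_; length; reverse; take; drop; concat; replicate)
open import Data.List.Relation.Binary.Permutation.Propositional using (_↭_)
open import Data.Product using (Σ; _×_; ∃-syntax)
open import Relation.Binary.PropositionalEquality using (_≡_)
open import Data.Maybe using (Maybe; just)

-- The alphabet {0,...,6}: letter k is represented by (k : Fin 7).
Letter : Set
Letter = Fin 7

Str : Set
Str = List Letter

pow : Str → ℕ → Str
pow U m = concat (replicate m U)

U2t : Str → Str
U2t P = (Fin.zero ∷ P) ++ (Fin.suc Fin.zero ∷ Fin.suc (Fin.suc Fin.zero) ∷ []) ++ reverse P ++ (Fin.zero ∷ [])
  where import Data.Fin as Fin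

AbelianEquiv : Str → Str → Set
AbelianEquiv X Y = X ↭ Y

IsAbelianSquare : Str → Set
IsAbelianSquare W = ∃[ X ] ∃[ Y ] (W ≡ X ++ Y × 1 ≤ length X × 1 ≤ length Y × AbelianEquiv X Y)

-- the factor S[i .. i+len-1] (0-based start i, length len)
factor : Str → ℕ → ℕ → Str
factor S i len = take len (drop i S)

HasAbelianSquareFactor : Str → Set
HasAbelianSquareFactor S = ∃[ i ] ∃[ len ] (i + len ≤ length S × IsAbelianSquare (factor S i len))

at : Str → ℕ → Maybe Letter
at [] _ = Maybe.nothing where import Data.Maybe as Maybe
at (x ∷ _) zero = just x
at (_ ∷ xs) (suc j) = at xs j

{-# OPTIONS --safe #-}
module Submission where

-- Let s be the infinite word U U U ⋯ of period n = 2t, so that the factors of (U_{2t})^m are windows of s.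
-- Whether the window of length 2r starting at d is an Abelian square depends only on d and r modulo n,
-- because a whole period read from any position is a permutation of U. For t < r < n the two halves share
-- a block of length 2r − n, and cancelling it leaves half-length n − r < t. For 0 < r < t the letters 1
-- and 2, which occur once per period, and the letter 0, which occurs only at the junctions 0|0 of
-- consecutive copies of U, force the centre to be such a junction: any other square would lie inside
-- 0 P or P^R 0, giving an Abelian square in P. At a junction the two halves are mirror images, as U is a
-- palindrome apart from its middle letters 1 2. Finally r = t is impossible: each half would need the
-- single letter 1 of a period.

open import Defs
open import Data.Empty using (⊥-elim)
open import Data.Fin using (zero; suc; toℕ)
open import Data.List using (List; []; _∷_; _++_; [_]; length; reverse; take; drop)
open import Data.List.Properties using (length-++; length-reverse; ++-assoc; reverse-++; unfold-reverse; ∷-injective)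
open import Data.List.Membership.Propositional using (_∈_; _∉_)
open import Data.List.Membership.Propositional.Properties using (∈-++⁺ˡ; ∈-++⁺ʳ; ∈-++⁻; ∈-∃++)
open import Data.List.Relation.Binary.Permutation.Propositional
  using (_↭_; ↭-refl; ↭-sym; ↭-trans; ↭-reflexive; module PermutationReasoning)
open import Data.List.Relation.Binary.Permutation.Propositional.Properties
  using (drop-∷; ++-comm; ++⁺; ++⁺ˡ; shift; ∈-resp-↭; ↭-reverse; ↭-length)
open import Data.List.Relation.Unary.All as All using (All)
open import Data.List.Relation.Unary.Any using (here; there)
open import Data.List.Relation.Unary.Any.Properties using (reverse⁻)
open import Data.Maybe using (just; fromMaybe)
open import Data.Maybe.Properties using (just-injective)
open import Data.Nat using (ℕ; NonZero; zero; suc; _+_; _*_; _∸_; _≤_; _<_; z≤n; s≤s; _%_; _/_)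
open import Data.Nat.DivMod
open import Data.Nat.Divisibility using (_∣_; divides; m%n≡0⇒n∣m; m%n≡0⇔n∣m; *-cancelˡ-∣; *-monoʳ-∣)
open import Data.Nat.Properties
open import Data.Nat.Tactic.RingSolver using (solve-∀)
open import Data.Product using (_×_; _,_; proj₁; proj₂; ∃-syntax; assocʳ′; assocˡ′)
open import Data.Product.Function.NonDependent.Propositional using (_×-⇔_)
open import Data.Sum using (_⊎_; inj₁; inj₂)
open import Data.Sum.Function.Propositional using (_⊎-⇔_)
open import Function.Base using (id)
open import Function.Bundles using (_⇔_; mk⇔; Equivalence)
open import Function.Properties.Equivalence using (⇔-setoid) renaming (refl to ⇔-refl; sym to ⇔-sym)
open import Function.Related.TypeIsomorphisms using (¬-cong-⇔)
open import Level using (0ℓ)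
open import Relation.Binary.Definitions using (tri<; tri≈; tri>)
open import Relation.Binary.PropositionalEquality
  using (_≡_; _≢_; refl; sym; trans; cong; cong₂; subst; subst₂; module ≡-Reasoning)
import Relation.Binary.Reasoning.Setoid as SetoidReasoning
open import Relation.Nullary using (¬_; yes; no; contradiction)

private variable
  A : Set
  x : A
  xs ys zs us vs : List A
  w : ℕ → A
  a b c d e i j L M p r : ℕ

module ⇔-Reasoning = SetoidReasoning (⇔-setoid 0ℓ)

++-cancelˡ-↭ : ∀ (zs : List A) → zs ++ xs ↭ zs ++ ys → xs ↭ ys
++-cancelˡ-↭ []       p = p
++-cancelˡ-↭ (z ∷ zs) p = ++-cancelˡ-↭ zs (drop-∷ p)

++-cancelʳ-↭ : ∀ (zs : List A) → xs ++ zs ↭ ys ++ zs → xs ↭ ys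
++-cancelʳ-↭ {xs = xs} {ys = ys} zs p =
  ++-cancelˡ-↭ zs (↭-trans (++-comm zs xs) (↭-trans p (++-comm ys zs)))

++-cancelʳ-↭⇔ : zs ↭ us → (xs ++ zs ↭ ys ++ us) ⇔ (xs ↭ ys)
++-cancelʳ-↭⇔ {zs = zs} {ys = ys} zs↭us = mk⇔
  (λ p → ++-cancelʳ-↭ zs (↭-trans p (++⁺ˡ ys (↭-sym zs↭us))))
  (λ p → ++⁺ p zs↭us)

++-injective-length : ∀ (xs us : List A) → length xs ≡ length us →
                      xs ++ ys ≡ us ++ vs → xs ≡ us × ys ≡ vs
++-injective-length []       []       _  eq = refl , eq
++-injective-length (x ∷ xs) (u ∷ us) ∣xs∣ eq
  with refl , eq₁ ← ∷-injective eq
  with refl , eq₂ ← ++-injective-length xs us (suc-injective ∣xs∣) eq₁ = refl , eq₂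

∈-++-↭ : xs ↭ ys → x ∈ xs ++ ys → x ∈ xs × x ∈ ys
∈-++-↭ {xs = xs} xs↭ys x∈ with ∈-++⁻ xs x∈
... | inj₁ x∈xs = x∈xs , ∈-resp-↭ xs↭ys x∈xs
... | inj₂ x∈ys = ∈-resp-↭ (↭-sym xs↭ys) x∈ys , x∈ys

↭-resp-≡⇔ : xs ≡ us → ys ≡ vs → (xs ↭ ys) ⇔ (us ↭ vs)
↭-resp-≡⇔ refl refl = mk⇔ id id

↭-respˡ-↭⇔ : xs ↭ us → (xs ↭ ys) ⇔ (us ↭ ys)
↭-respˡ-↭⇔ xs↭us = mk⇔ (↭-trans (↭-sym xs↭us)) (↭-trans xs↭us)

∃-×-cong⇔ : {P Q R : A → Set} → (∀ a → P a → Q a ⇔ R a) → (∃[ a ] (P a × Q a)) ⇔ (∃[ a ] (P a × R a))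
∃-×-cong⇔ Q⇔R = mk⇔ (λ (a , p , q) → a , p , Equivalence.to (Q⇔R a p) q)
                    (λ (a , p , r) → a , p , Equivalence.from (Q⇔R a p) r)

Once : A → List A → Set
Once x xs = ∃[ R ] (xs ↭ x ∷ R × x ∉ R)

Once-resp-↭ : xs ↭ ys → Once x ys → Once x xs
Once-resp-↭ xs↭ys (R , ys↭ , x∉R) = R , ↭-trans xs↭ys ys↭ , x∉R

Once-++⇒∉ : Once x (xs ++ ys) → x ∈ xs → x ∉ ys
Once-++⇒∉ {x = x} {ys = ys} (R , xs++ys↭ , x∉R) x∈xs x∈ys
  with as , bs , refl ← ∈-∃++ x∈xs = x∉R (∈-resp-↭ rest↭R (∈-++⁺ʳ as (∈-++⁺ʳ bs x∈ys)))
  where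
  rest↭R : as ++ bs ++ ys ↭ R
  rest↭R = drop-∷ (↭-trans (↭-sym (shift x as (bs ++ ys)))
             (↭-trans (↭-reflexive (sym (++-assoc as (x ∷ bs) ys))) xs++ys↭))

-- Windows of infinite words

window : (ℕ → A) → ℕ → ℕ → List A
window w a zero    = []
window w a (suc L) = w a ∷ window w (suc a) L

length-window : ∀ (w : ℕ → A) a L → length (window w a L) ≡ L
length-window w a zero    = refl
length-window w a (suc L) = cong suc (length-window w (suc a) L)

window-++ : ∀ (w : ℕ → A) a L M → window w a (L + M) ≡ window w a L ++ window w (a + L) M
window-++ w a zero    M = cong (λ c → window w c M) (sym (+-identityʳ a))
window-++ w a (suc L) M = cong (w a ∷_)
  (trans (window-++ w (suc a) L M) (cong (λ c → window w (suc a) L ++ window w c M) (sym (+-suc a L))))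

window-snoc : ∀ (w : ℕ → A) a L → window w a (suc L) ≡ window w a L ++ [ w (a + L) ]
window-snoc w a L = trans (cong (window w a) (+-comm 1 L)) (window-++ w a L 1)

window-∘suc : ∀ (w : ℕ → A) a L → window w (suc a) L ≡ window (λ c → w (suc c)) a L
window-∘suc w a zero    = refl
window-∘suc w a (suc L) = cong (w (suc a) ∷_) (window-∘suc w (suc a) L)

window-cong : ∀ {w v : ℕ → A} a L → (∀ j → a ≤ j → j < a + L → w j ≡ v j) →
              window w a L ≡ window v a L
window-cong a zero    _  = refl
window-cong a (suc L) eq = cong₂ _∷_
  (eq a ≤-refl (m<m+n a (s≤s z≤n)))
  (window-cong (suc a) L λ j a<j j< → eq j (<⇒≤ a<j) (subst (j <_) (sym (+-suc a L)) j<))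

∈-window⁺ : ∀ (w : ℕ → A) a L → a ≤ j → j < a + L → w j ∈ window w a L
∈-window⁺ {j = j} w a zero    a≤j j< = ⊥-elim (<⇒≱ (subst (j <_) (+-identityʳ a) j<) a≤j)
∈-window⁺ {j = j} w a (suc L) a≤j j< with a ≟ j
... | yes refl = here refl
... | no a≢j   = there (∈-window⁺ w (suc a) L (≤∧≢⇒< a≤j a≢j) (subst (j <_) (+-suc a L) j<))

∈-window⁻ : ∀ (w : ℕ → A) a L → x ∈ window w a L → ∃[ j ] (a ≤ j × j < a + L × w j ≡ x)
∈-window⁻ w a (suc L) (here refl) = a , ≤-refl , m<m+n a (s≤s z≤n) , refl
∈-window⁻ w a (suc L) (there x∈) with j , a<j , j< , eq ← ∈-window⁻ w (suc a) L x∈ =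
  j , <⇒≤ a<j , subst (j <_) (sym (+-suc a L)) j< , eq

length-reverse-window : ∀ (w : ℕ → A) a L → length (reverse (window w a L)) ≡ L
length-reverse-window w a L = trans (length-reverse (window w a L)) (length-window w a L)

take-window : ∀ (w : ℕ → A) a L M → take L (window w a (L + M)) ≡ window w a L
take-window w a zero    M = refl
take-window w a (suc L) M = cong (w a ∷_) (take-window w (suc a) L M)

drop-window : ∀ (w : ℕ → A) a L M → drop L (window w a (L + M)) ≡ window w (a + L) M
drop-window w a zero    M = cong (λ c → window w c M) (sym (+-identityʳ a))
drop-window w a (suc L) M = trans (drop-window w (suc a) L M) (cong (λ c → window w c M) (sym (+-suc a L)))

window-reverse-sub : ∀ (w : ℕ → A) a b i M c → i + M + c ≡ L →
                     window w a L ≡ reverse (window w b L) →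
                     window w (a + i) M ≡ reverse (window w (b + c) M)
window-reverse-sub w a b i M c refl mirror =
  proj₁ (++-injective-length (window w (a + i) M) (reverse (window w (b + c) M))
                             (trans (length-window w (a + i) M) (sym (length-reverse-window w (b + c) M)))
                             (proj₂ (++-injective-length (window w a i) (reverse (window w (b + (c + M)) i))
                                                         (trans (length-window w a i) (sym (length-reverse-window w (b + (c + M)) i)))
                                                         split)))
  where
  open ≡-Reasoning
  reorder : ∀ i M c → i + M + c ≡ c + M + i
  reorder = solve-∀
  split : window w a i ++ window w (a + i) M ++ window w (a + (i + M)) c
        ≡ reverse (window w (b + (c + M)) i) ++ reverse (window w (b + c) M) ++ reverse (window w b c)
  split = begin
    window w a i ++ window w (a + i) M ++ window w (a + (i + M)) c
      ≡⟨ sym (++-assoc (window w a i) _ _) ⟩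
    (window w a i ++ window w (a + i) M) ++ window w (a + (i + M)) c
      ≡⟨ cong (_++ window w (a + (i + M)) c) (sym (window-++ w a i M)) ⟩
    window w a (i + M) ++ window w (a + (i + M)) c
      ≡⟨ sym (window-++ w a (i + M) c) ⟩
    window w a (i + M + c)
      ≡⟨ mirror ⟩
    reverse (window w b (i + M + c))
      ≡⟨ cong (λ L → reverse (window w b L)) (reorder i M c) ⟩
    reverse (window w b (c + M + i))
      ≡⟨ cong reverse (window-++ w b (c + M) i) ⟩
    reverse (window w b (c + M) ++ window w (b + (c + M)) i)
      ≡⟨ reverse-++ (window w b (c + M)) _ ⟩
    reverse (window w (b + (c + M)) i) ++ reverse (window w b (c + M))
      ≡⟨ cong (λ zs → reverse (window w (b + (c + M)) i) ++ reverse zs) (window-++ w b c M) ⟩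
    reverse (window w (b + (c + M)) i) ++ reverse (window w b c ++ window w (b + c) M)
      ≡⟨ cong (reverse (window w (b + (c + M)) i) ++_) (reverse-++ (window w b c) _) ⟩
    reverse (window w (b + (c + M)) i) ++ reverse (window w (b + c) M) ++ reverse (window w b c) ∎

-- Abelian squares in infinite words

AbelianSquareAt : (ℕ → A) → ℕ → ℕ → Set
AbelianSquareAt w d r = window w d r ↭ window w (d + r) r

AbelianSquareAt-reverse : ∀ (w : ℕ → A) a b r → window w a (r + r) ≡ reverse (window w b (r + r)) →
                          AbelianSquareAt w a r → AbelianSquareAt w b r
AbelianSquareAt-reverse w a b r mirror sq = begin
  window w b r                   ↭⟨ ↭-reverse (window w b r) ⟨
  reverse (window w b r)         ≡⟨ proj₂ reversed ⟨
  window w (a + r) r             ↭⟨ sq ⟨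
  window w a r                   ≡⟨ proj₁ reversed ⟩
  reverse (window w (b + r) r)   ↭⟨ ↭-reverse _ ⟩
  window w (b + r) r             ∎
  where
  open PermutationReasoning
  halves : window w a r ++ window w (a + r) r ≡ reverse (window w (b + r) r) ++ reverse (window w b r)
  halves = trans (sym (window-++ w a r r))
                 (trans mirror (trans (cong reverse (window-++ w b r r)) (reverse-++ (window w b r) _)))
  reversed : window w a r ≡ reverse (window w (b + r) r) × window w (a + r) r ≡ reverse (window w b r)
  reversed = ++-injective-length _ _ (trans (length-window w a r) (sym (length-reverse-window w (b + r) r))) halves

Periodic : (ℕ → A) → ℕ → Set
Periodic w p = ∀ j → w (j + p) ≡ w j

periodic-* : Periodic w p → ∀ q → Periodic w (q * p)
periodic-* {w = w} per zero    j = cong w (+-identityʳ j)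
periodic-* {w = w} {p = p} per (suc q) j =
  trans (cong w (sym (+-assoc j p (q * p)))) (trans (periodic-* per q (j + p)) (per j))

window-periodic : Periodic w p → ∀ a L → window w (a + p) L ≡ window w a L
window-periodic per a zero    = refl
window-periodic per a (suc L) = cong₂ _∷_ (per a) (window-periodic per (suc a) L)

window-rotate-step : ∀ (w : ℕ → A) a L → w (a + L) ≡ w a → window w (suc a) L ↭ window w a L
window-rotate-step w a zero    _  = ↭-refl
window-rotate-step w a (suc L) eq = ↭-trans (↭-reflexive (window-snoc w (suc a) L))
  (↭-trans (↭-reflexive (cong (λ c → window w (suc a) L ++ [ c ]) (trans (cong w (sym (+-suc a L))) eq)))
           (++-comm (window w (suc a) L) [ w a ]))

window-rotate : Periodic w p → ∀ a b → window w a p ↭ window w b p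
window-rotate {w = w} {p = p} per a b = ↭-trans (to0 a) (↭-sym (to0 b))
  where
  to0 : ∀ a → window w a p ↭ window w 0 p
  to0 zero    = ↭-refl
  to0 (suc a) = ↭-trans (window-rotate-step w a p (per a)) (to0 a)

AbelianSquareAt-shift : Periodic w p → AbelianSquareAt w (d + p) r ⇔ AbelianSquareAt w d r
AbelianSquareAt-shift {w = w} {p = p} {d = d} {r = r} per =
  ↭-resp-≡⇔ (window-periodic per d r)
            (trans (cong (λ a → window w a r) (+-comm-middle d p r)) (window-periodic per (d + r) r))
  where
  +-comm-middle : ∀ d p r → d + p + r ≡ d + r + p
  +-comm-middle = solve-∀

AbelianSquareAt-extend : Periodic w p → AbelianSquareAt w d (r + p) ⇔ AbelianSquareAt w d r
AbelianSquareAt-extend {w = w} {p = p} {d = d} {r = r} per = begin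
  AbelianSquareAt w d (r + p)
    ≈⟨ ↭-resp-≡⇔ (window-++ w d r p) (window-++ w (d + (r + p)) r p) ⟩
  (window w d r ++ window w (d + r) p ↭ window w (d + (r + p)) r ++ window w (d + (r + p) + r) p)
    ≡⟨ cong (λ Y → window w d r ++ window w (d + r) p ↭ Y ++ window w (d + (r + p) + r) p) Y≡ ⟩
  (window w d r ++ window w (d + r) p ↭ window w (d + r) r ++ window w (d + (r + p) + r) p)
    ≈⟨ ++-cancelʳ-↭⇔ (window-rotate per (d + r) (d + (r + p) + r)) ⟩
  AbelianSquareAt w d r ∎
  where
  open ⇔-Reasoning
  Y≡ : window w (d + (r + p)) r ≡ window w (d + r) r
  Y≡ = trans (cong (λ a → window w a r) (sym (+-assoc d r p))) (window-periodic per (d + r) r)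

window-periodic-wrap : Periodic w p → ∀ e r → e + r + r ≡ p → ∀ d →
                       window w (d + (e + r)) (e + r) ≡ window w (d + e + r) r ++ window w d e
window-periodic-wrap {w = w} {p = p} per e r e+r+r≡p d = begin
  window w (d + (e + r)) (e + r)                        ≡⟨ cong₂ (window w) (sym (+-assoc d e r)) (+-comm e r) ⟩
  window w (d + e + r) (r + e)                          ≡⟨ window-++ w (d + e + r) r e ⟩
  window w (d + e + r) r ++ window w (d + e + r + r) e  ≡⟨ cong (λ a → window w (d + e + r) r ++ window w a e) d+e+r+r≡d+p ⟩
  window w (d + e + r) r ++ window w (d + p) e          ≡⟨ cong (window w (d + e + r) r ++_) (window-periodic per d e) ⟩
  window w (d + e + r) r ++ window w d e                ∎
  where
  open ≡-Reasoning
  assoc : ∀ d e r → d + e + r + r ≡ d + (e + r + r)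
  assoc = solve-∀
  d+e+r+r≡d+p : d + e + r + r ≡ d + p
  d+e+r+r≡d+p = trans (assoc d e r) (cong (d +_) e+r+r≡p)

AbelianSquareAt-complement : Periodic w p → e + r + r ≡ p →
                             AbelianSquareAt w d (e + r) ⇔ AbelianSquareAt w (d + e) r
AbelianSquareAt-complement {w = w} {e = e} {r = r} {d = d} per e+r+r≡p = begin
  AbelianSquareAt w d (e + r)
    ≈⟨ ↭-resp-≡⇔ (window-++ w d e r) (window-periodic-wrap per e r e+r+r≡p d) ⟩
  (window w d e ++ window w (d + e) r ↭ window w (d + e + r) r ++ window w d e)
    ≈⟨ ↭-respˡ-↭⇔ (++-comm (window w d e) (window w (d + e) r)) ⟩
  (window w (d + e) r ++ window w d e ↭ window w (d + e + r) r ++ window w d e)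
    ≈⟨ ++-cancelʳ-↭⇔ ↭-refl ⟩
  AbelianSquareAt w (d + e) r ∎
  where open ⇔-Reasoning

AbelianSquareAt-once : Periodic w p → r + r ≤ p → Once x (window w 0 p) →
                       x ∈ window w d (r + r) → ¬ AbelianSquareAt w d r
AbelianSquareAt-once {w = w} {p = p} {r = r} {d = d} per r+r≤p once x∈ sq
  with c , r+r+c≡p ← m≤n⇒∃[o]m+o≡n r+r≤p
  with x∈X , x∈Y ← ∈-++-↭ sq (subst (_ ∈_) (window-++ w d r r) x∈) =
  Once-++⇒∉ (Once-resp-↭ (↭-reflexive (sym period≡)) (Once-resp-↭ (window-rotate per d 0) once))
            x∈X (∈-++⁺ˡ x∈Y)
  where
  open ≡-Reasoning
  period≡ : window w d p ≡ window w d r ++ window w (d + r) r ++ window w (d + (r + r)) c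
  period≡ = begin
    window w d p                                                     ≡⟨ cong (window w d) r+r+c≡p ⟨
    window w d (r + r + c)                                           ≡⟨ window-++ w d (r + r) c ⟩
    window w d (r + r) ++ window w (d + (r + r)) c                   ≡⟨ cong (_++ window w (d + (r + r)) c) (window-++ w d r r) ⟩
    (window w d r ++ window w (d + r) r) ++ window w (d + (r + r)) c ≡⟨ ++-assoc (window w d r) _ _ ⟩
    window w d r ++ window w (d + r) r ++ window w (d + (r + r)) c   ∎

factor-window : ∀ (u : ℕ → Letter) a i L M → i + L ≤ M → factor (window u a M) i L ≡ window u (a + i) L
factor-window u a i L M i+L≤M with c , refl ← m≤n⇒∃[o]m+o≡n i+L≤M = begin
  take L (drop i (window u a (i + L + c)))   ≡⟨ cong (λ M → take L (drop i (window u a M))) (+-assoc i L c) ⟩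
  take L (drop i (window u a (i + (L + c)))) ≡⟨ cong (take L) (drop-window u a i (L + c)) ⟩
  take L (window u (a + i) (L + c))          ≡⟨ take-window u (a + i) L c ⟩
  window u (a + i) L                         ∎
  where open ≡-Reasoning

at-window : ∀ (u : ℕ → Letter) a L j → j < L → at (window u a L) j ≡ just (u (a + j))
at-window u a (suc L) zero    _         = cong (λ c → just (u c)) (sym (+-identityʳ a))
at-window u a (suc L) (suc j) (s≤s j<L) = trans (at-window u (suc a) L j j<L) (cong (λ c → just (u c)) (sym (+-suc a j)))

window-at : ∀ (xs : Str) → window (λ j → fromMaybe zero (at xs j)) 0 (length xs) ≡ xs
window-at []       = refl
window-at (x ∷ xs) = cong (x ∷_) (trans (window-∘suc _ 0 (length xs)) (window-at xs))

IsAbelianSquare-window⇔ : ∀ (u : ℕ → Letter) d L → 1 ≤ L →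
                          IsAbelianSquare (window u d L) ⇔ (∃[ r ] (L ≡ r + r × AbelianSquareAt u d r))
IsAbelianSquare-window⇔ u d L 1≤L = mk⇔ to from
  where
  to : IsAbelianSquare (window u d L) → ∃[ r ] (L ≡ r + r × AbelianSquareAt u d r)
  to (X , Y , eq , _ , _ , X↭Y) = h , L≡ , subst₂ _↭_ (sym (proj₁ halves)) (sym (proj₂ halves)) X↭Y
    where
    h : ℕ
    h = length X
    L≡ : L ≡ h + h
    L≡ = trans (sym (length-window u d L))
               (trans (cong length eq) (trans (length-++ X) (cong (h +_) (sym (↭-length X↭Y)))))
    halves : window u d h ≡ X × window u (d + h) h ≡ Y
    halves = ++-injective-length _ X (length-window u d h)
               (trans (sym (window-++ u d h h)) (trans (cong (window u d) (sym L≡)) eq))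
  from : ∃[ r ] (L ≡ r + r × AbelianSquareAt u d r) → IsAbelianSquare (window u d L)
  from (r , refl , sq) = window u d r , window u (d + r) r , window-++ u d r r ,
    subst (1 ≤_) (sym (length-window u d r)) (half-pos r 1≤L) ,
    subst (1 ≤_) (sym (length-window u (d + r) r)) (half-pos r 1≤L) , sq
    where
    half-pos : ∀ r → 1 ≤ r + r → 1 ≤ r
    half-pos (suc r) _ = s≤s z≤n

≡⇔%≡0 : ∀ {m n} .{{_ : NonZero n}} → 1 ≤ m → m < n + n → (m ≡ n) ⇔ (m % n ≡ 0)
≡⇔%≡0 {m} {n} 1≤m m<n+n = mk⇔ (λ { refl → n%n≡0 n }) (λ m%n≡0 → multiple (m%n≡0⇒n∣m m n m%n≡0))
  where
  multiple : n ∣ m → m ≡ n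
  multiple (divides zero          refl) = contradiction 1≤m λ ()
  multiple (divides (suc zero)    refl) = +-identityʳ n
  multiple (divides (suc (suc q)) refl) = contradiction m<n+n (≤⇒≯ (+-monoʳ-≤ n (m≤m+n n (q * n))))

half-injective : ∀ {m n} → m + m ≡ n + n → m ≡ n
half-injective {zero}  {zero}  _  = refl
half-injective {suc m} {suc n} eq =
  cong suc (half-injective (suc-injective (trans (sym (+-suc m m)) (trans (suc-injective eq) (+-suc n n)))))

-- The infinite power of U_{2t}

Big : Letter → Set
Big c = 3 ≤ toℕ c

≡zero⇒¬Big : ∀ {c} → c ≡ zero → ¬ Big c
≡zero⇒¬Big refl ()

¬Big⇒∉ : ∀ {c} {xs : Str} → ¬ Big c → All Big xs → c ∉ xs
¬Big⇒∉ ¬big big c∈ = ¬big (All.lookup big c∈)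

module Periodic-U2t (P : Str) (P-big : All Big P) (P-square-free : ¬ HasAbelianSquareFactor P) where

  one two : Letter
  one = suc zero
  two = suc (suc zero)

  U : Str
  U = U2t P

  -- Within the first period of s: 0 at 0, P on [1, K), 1 at K, 2 at t, P^R on [t + 1, n-1), 0 at n-1.
  k K t n n-1 : ℕ
  k   = length P
  K   = suc k
  t   = suc K
  n   = t + t
  n-1 = suc t + k

  length-U : length U ≡ n
  length-U = begin
    length U                                              ≡⟨ cong suc (length-++ P) ⟩
    suc (k + suc (suc (length (reverse P ++ [ zero ]))))  ≡⟨ cong (λ l → suc (k + suc (suc l))) (length-++ (reverse P)) ⟩
    suc (k + suc (suc (length (reverse P) + 1)))          ≡⟨ cong (λ l → suc (k + suc (suc (l + 1)))) (length-reverse P) ⟩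
    suc (k + suc (suc (k + 1)))                           ≡⟨ arith k ⟩
    n                                                     ∎
    where
    open ≡-Reasoning
    arith : ∀ k → suc (k + suc (suc (k + 1))) ≡ suc (suc k) + suc (suc k)
    arith = solve-∀

  -- The default letter is never used, as j % n < length U.
  s : ℕ → Letter
  s j = fromMaybe zero (at U (j % n))

  s-periodic : Periodic s n
  s-periodic j = cong (λ c → fromMaybe zero (at U c)) ([m+n]%n≡m%n j n)

  s-% : ∀ j → s (j % n) ≡ s j
  s-% j = cong (λ c → fromMaybe zero (at U c)) (m%n%n≡m%n j n)

  window-s : window s 0 n ≡ U
  window-s = begin
    window s 0 n                                           ≡⟨ window-cong 0 n (λ j _ j<n → cong (λ c → fromMaybe zero (at U c)) (m<n⇒m%n≡m j<n)) ⟩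
    window (λ j → fromMaybe zero (at U j)) 0 n             ≡⟨ cong (window _ 0) length-U ⟨
    window (λ j → fromMaybe zero (at U j)) 0 (length U)   ≡⟨ window-at U ⟩
    U                                                      ∎
    where open ≡-Reasoning

  pow-window : ∀ m → pow U m ≡ window s 0 (m * n)
  pow-window zero    = refl
  pow-window (suc m) = begin
    U ++ pow U m                        ≡⟨ cong₂ _++_ (sym window-s) (pow-window m) ⟩
    window s 0 n ++ window s 0 (m * n)  ≡⟨ cong (window s 0 n ++_) (window-periodic s-periodic 0 (m * n)) ⟨
    window s 0 n ++ window s n (m * n)  ≡⟨ window-++ s 0 n (m * n) ⟨
    window s 0 (n + m * n)              ∎
    where open ≡-Reasoning

  private
    n≡1+k+1+t : suc (k + suc t) ≡ n
    n≡1+k+1+t = arith k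
      where
      arith : ∀ k → suc (k + suc (suc (suc k))) ≡ suc (suc k) + suc (suc k)
      arith = solve-∀

  record Layout : Set where
    field
      s-0       : s 0 ≡ zero
      window-P  : window s 1 k ≡ P
      s-K       : s K ≡ one
      s-t       : s t ≡ two
      window-Pʳ : window s (suc t) k ≡ reverse P
      s-n-1     : s n-1 ≡ zero

  layout : Layout
  layout
    with s0 , rest ← ∷-injective (trans (cong (window s 0) n≡1+k+1+t) window-s)
    with P≡ , rest ← ++-injective-length (window s 1 k) P (length-window s 1 k)
                       (trans (sym (window-++ s 1 k (suc t))) rest)
    with sK , rest ← ∷-injective rest
    with st , rest ← ∷-injective rest
    with Pʳ≡ , [n-1]≡ ← ++-injective-length (window s (suc t) k) (reverse P)
                          (trans (length-window s (suc t) k) (sym (length-reverse P)))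
                          (trans (sym (window-snoc s (suc t) k)) rest) =
    record { s-0 = s0 ; window-P = P≡ ; s-K = sK ; s-t = st ; window-Pʳ = Pʳ≡ ; s-n-1 = proj₁ (∷-injective [n-1]≡) }

  open Layout layout public

  window-mirror : window s (suc t) K ≡ reverse (window s 0 K)
  window-mirror = begin
    window s (suc t) K                   ≡⟨ window-snoc s (suc t) k ⟩
    window s (suc t) k ++ [ s n-1 ]      ≡⟨ cong₂ (λ xs c → xs ++ [ c ]) window-Pʳ s-n-1 ⟩
    reverse P ++ [ zero ]                ≡⟨ unfold-reverse zero P ⟨
    reverse (zero ∷ P)                   ≡⟨ cong reverse (cong₂ _∷_ s-0 window-P) ⟨
    reverse (window s 0 K)               ∎
    where open ≡-Reasoning

  big-P : 1 ≤ j → j < K → Big (s j)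
  big-P {j} 1≤j j<K = All.lookup P-big (subst (s j ∈_) window-P (∈-window⁺ s 1 k 1≤j j<K))

  big-Pʳ : suc t ≤ j → j < n-1 → Big (s j)
  big-Pʳ {j} t<j j<n-1 = All.lookup P-big (reverse⁻ (subst (s j ∈_) window-Pʳ (∈-window⁺ s (suc t) k t<j j<n-1)))

  zero∉window : ∀ a L → (∀ j → a ≤ j → j < a + L → Big (s j)) → zero ∉ window s a L
  zero∉window a L big zero∈ with j , a≤j , j< , sj≡0 ← ∈-window⁻ s a L zero∈ =
    ≡zero⇒¬Big sj≡0 (big j a≤j j<)

  private
    frame∌ : ∀ x y → x ≢ zero → x ≢ y → ¬ Big x → x ∉ zero ∷ P ++ y ∷ reverse P ++ [ zero ]
    frame∌ x y x≢0 x≢y ¬big (here x≡0) = x≢0 x≡0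
    frame∌ x y x≢0 x≢y ¬big (there x∈) with ∈-++⁻ P x∈
    ... | inj₁ x∈P = ¬Big⇒∉ ¬big P-big x∈P
    ... | inj₂ (here x≡y) = x≢y x≡y
    ... | inj₂ (there x∈R) with ∈-++⁻ (reverse P) x∈R
    ...   | inj₁ x∈Pʳ        = ¬Big⇒∉ ¬big P-big (reverse⁻ x∈Pʳ)
    ...   | inj₂ (here x≡0) = x≢0 x≡0

  once-one : Once one (window s 0 n)
  once-one = zero ∷ P ++ two ∷ reverse P ++ [ zero ] ,
             ↭-trans (↭-reflexive window-s) (shift one (zero ∷ P) (two ∷ reverse P ++ [ zero ])) ,
             frame∌ one two (λ ()) (λ ()) λ { (s≤s ()) }

  once-two : Once two (window s 0 n)
  once-two = zero ∷ P ++ one ∷ reverse P ++ [ zero ] ,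
             ↭-trans (↭-reflexive (trans window-s (cong (zero ∷_) (sym (++-assoc P [ one ] (two ∷ R))))))
               (↭-trans (shift two (zero ∷ P ++ [ one ]) R) (↭-reflexive (cong (λ l → two ∷ zero ∷ l) (++-assoc P [ one ] R)))) ,
             frame∌ two one (λ ()) (λ ()) λ { (s≤s (s≤s ())) }
    where
    R : Str
    R = reverse P ++ [ zero ]

  private
    n≡1+t+K : n ≡ suc t + K
    n≡1+t+K = cong suc (+-comm K t)

    r≤K⇒r+r≤n : r ≤ K → r + r ≤ n
    r≤K⇒r+r≤n r≤K = +-mono-≤ (m≤n⇒m≤1+n r≤K) (m≤n⇒m≤1+n r≤K)

  ¬square-∋ : ∀ {x} → Once x (window s 0 n) → ∀ p → d ≤ p → p < d + (r + r) → s p ≡ x → r ≤ K →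
              ¬ AbelianSquareAt s d r
  ¬square-∋ {d} {r} once p d≤p p< sp≡x r≤K =
    AbelianSquareAt-once s-periodic (r≤K⇒r+r≤n r≤K) once (subst (_∈ window s d (r + r)) sp≡x (∈-window⁺ s d (r + r) d≤p p<))

  ¬square-prefix : d + (r + r) ≤ K → 1 ≤ r → ¬ AbelianSquareAt s d r
  ¬square-prefix {zero} {r} bound 1≤r sq = zero∉window r r big-Y (∈-resp-↭ sq zero∈X)
    where
    zero∈X : zero ∈ window s 0 r
    zero∈X = subst (_∈ window s 0 r) s-0 (∈-window⁺ s 0 r z≤n 1≤r)
    big-Y : ∀ j → r ≤ j → j < r + r → Big (s j)
    big-Y j r≤j j< = big-P (≤-trans 1≤r r≤j) (<-≤-trans j< bound)
  ¬square-prefix {suc d} {r} bound 1≤r sq = P-square-free (d , r + r , d+r+r≤k , factor-square)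
    where
    d+r+r≤k : d + (r + r) ≤ k
    d+r+r≤k = ≤-pred bound
    factor-square : IsAbelianSquare (factor P d (r + r))
    factor-square = subst IsAbelianSquare
      (trans (sym (factor-window s 1 d (r + r) k d+r+r≤k)) (cong (λ xs → factor xs d (r + r)) window-P))
      (Equivalence.from (IsAbelianSquare-window⇔ s (suc d) (r + r) (≤-trans 1≤r (m≤m+n r r))) (r , refl , sq))

  ¬square-suffix : suc t ≤ d → d + (r + r) ≤ n → 1 ≤ r → ¬ AbelianSquareAt s d r
  ¬square-suffix {d} {r} t<d bound 1≤r sq
    with i , refl ← m≤n⇒∃[o]m+o≡n t<d
    with c , i+r+r+c≡K ← m≤n⇒∃[o]m+o≡n (+-cancelˡ-≤ (suc t) (i + (r + r)) K
                                          (subst₂ _≤_ (+-assoc (suc t) i (r + r)) n≡1+t+K bound)) =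
    ¬square-prefix c+r+r≤K 1≤r
      (AbelianSquareAt-reverse s (suc t + i) c r
        (window-reverse-sub s (suc t) 0 i (r + r) c i+r+r+c≡K window-mirror) sq)
    where
    c+r+r≤K : c + (r + r) ≤ K
    c+r+r≤K = subst₂ _≤_ (+-comm (r + r) c) (trans (sym (+-assoc i (r + r) c)) i+r+r+c≡K) (m≤n+m (r + r + c) i)

  private
    square-mirrored : ∀ i → r + i ≡ K → AbelianSquareAt s (suc t + i) r
    square-mirrored {r} i r+i≡K =
      ↭-trans (↭-reflexive first-half) (↭-trans (↭-reverse (window s 0 r)) (↭-reflexive (sym second-half)))
      where
      first-half : window s (suc t + i) r ≡ reverse (window s 0 r)
      first-half = window-reverse-sub s (suc t) 0 i r 0 (trans (+-identityʳ (i + r)) (trans (+-comm i r) r+i≡K)) window-mirror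
      end≡n : suc t + i + r ≡ n
      end≡n = trans (+-assoc (suc t) i r) (trans (cong (suc t +_) (trans (+-comm i r) r+i≡K)) (sym n≡1+t+K))
      second-half : window s (suc t + i + r) r ≡ window s 0 r
      second-half = trans (cong (λ a → window s a r) end≡n) (window-periodic s-periodic 0 r)

  square-centred : d + r ≡ n → r ≤ K → AbelianSquareAt s d r
  square-centred {d} {r} d+r≡n r≤K with i , r+i≡K ← m≤n⇒∃[o]m+o≡n r≤K =
    subst (λ a → AbelianSquareAt s a r) (sym d≡) (square-mirrored i r+i≡K)
    where
    arith : ∀ a r i → a + (r + i) ≡ a + i + r
    arith = solve-∀
    d≡ : d ≡ suc t + i
    d≡ = +-cancelʳ-≡ r d (suc t + i) (trans d+r≡n (trans n≡1+t+K (trans (cong (suc t +_) (sym r+i≡K)) (arith (suc t) r i))))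

  private
    n≡1+n-1 : n ≡ suc n-1
    n≡1+n-1 = cong (λ l → suc (suc l)) (+-comm k t)

    s-n : s n ≡ zero
    s-n = trans (s-periodic 0) s-0

    s-n+K : s (n + K) ≡ one
    s-n+K = trans (cong s (+-comm n K)) (trans (s-periodic K) s-K)

    big-P-shifted : n < j → j < n + K → Big (s j)
    big-P-shifted {j} n<j j<n+K with i , refl ← m≤n⇒∃[o]m+o≡n n<j =
      subst Big (sym (trans (cong s (+-comm (suc n) i)) (trans (cong s (+-suc i n)) (s-periodic (suc i)))))
        (big-P (s≤s z≤n) (+-cancelˡ-< n (suc i) K (subst (_< n + K) (sym (+-suc n i)) j<n+K)))

  ¬square-start : d ≤ K → 1 ≤ r → r ≤ K → ¬ AbelianSquareAt s d r
  ¬square-start {d} {r} d≤K 1≤r r≤K with K <? d + (r + r)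
  ... | yes K< = ¬square-∋ once-one K d≤K K< s-K r≤K
  ... | no  K≮ = ¬square-prefix (≮⇒≥ K≮) 1≤r

  square-end⇒centred : t < d → d < n → 1 ≤ r → r ≤ K → AbelianSquareAt s d r → d + r ≡ n
  square-end⇒centred {d} {r} t<d d<n 1≤r r≤K sq with d + (r + r) ≤? n
  ... | yes end≤n = ⊥-elim (¬square-suffix t<d end≤n 1≤r sq)
  ... | no  end≰n with n + K <? d + (r + r)
  ...   | yes n+K< = ⊥-elim (¬square-∋ once-one (n + K) (≤-trans (<⇒≤ d<n) (m≤m+n n K)) n+K< s-n+K r≤K sq)
  ...   | no  n+K≮ with <-cmp (d + r) n
  ...     | tri≈ _ d+r≡n _ = d+r≡n
  ...     | tri< d+r<n _ _ = ⊥-elim (zero∉window d r big-X (∈-resp-↭ (↭-sym sq) zero∈Y))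
    where
    d+r≤n-1 : d + r ≤ n-1
    d+r≤n-1 = ≤-pred (subst (d + r <_) n≡1+n-1 d+r<n)
    zero∈Y : zero ∈ window s (d + r) r
    zero∈Y = subst (_∈ window s (d + r) r) s-n-1 (∈-window⁺ s (d + r) r d+r≤n-1
               (subst (n-1 <_) (sym (+-assoc d r r)) (<-trans (subst (n-1 <_) (sym n≡1+n-1) ≤-refl) (≰⇒> end≰n))))
    big-X : ∀ j → d ≤ j → j < d + r → Big (s j)
    big-X j d≤j j<d+r = big-Pʳ (≤-trans t<d d≤j) (<-≤-trans j<d+r d+r≤n-1)
  ...     | tri> _ _ n<d+r = ⊥-elim (zero∉window (d + r) r big-Y (∈-resp-↭ sq zero∈X))
    where
    zero∈X : zero ∈ window s d r
    zero∈X = subst (_∈ window s d r) s-n (∈-window⁺ s d r (<⇒≤ d<n) n<d+r)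
    big-Y : ∀ j → d + r ≤ j → j < d + r + r → Big (s j)
    big-Y j d+r≤j j< = big-P-shifted (<-≤-trans n<d+r d+r≤j)
                         (<-≤-trans j< (subst (_≤ n + K) (sym (+-assoc d r r)) (≮⇒≥ n+K≮)))

  square-short⇒centred : d < n → 1 ≤ r → r ≤ K → AbelianSquareAt s d r → d + r ≡ n
  square-short⇒centred {d} {r} d<n 1≤r r≤K sq with d ≤? K
  ... | yes d≤K = ⊥-elim (¬square-start d≤K 1≤r r≤K sq)
  ... | no  d≰K with d ≟ t
  ...   | yes refl = ⊥-elim (¬square-∋ once-two t ≤-refl (m<m+n t (≤-trans 1≤r (m≤m+n r r))) s-t r≤K sq)
  ...   | no  d≢t  = square-end⇒centred (≤∧≢⇒< (≰⇒> d≰K) (λ t≡d → d≢t (sym t≡d))) d<n 1≤r r≤K sq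

  square-mod : AbelianSquareAt s d r ⇔ AbelianSquareAt s (d % n) r
  square-mod {d} {r} = begin
    AbelianSquareAt s d r                       ≡⟨ cong (λ a → AbelianSquareAt s a r) (m≡m%n+[m/n]*n d n) ⟩
    AbelianSquareAt s (d % n + d / n * n) r     ≈⟨ AbelianSquareAt-shift (periodic-* s-periodic (d / n)) ⟩
    AbelianSquareAt s (d % n) r                 ∎
    where open ⇔-Reasoning

  square-short⇔ : 1 ≤ r → r ≤ K → AbelianSquareAt s d r ⇔ ((d + r) % n ≡ 0)
  square-short⇔ {r} {d} 1≤r r≤K = begin
    AbelianSquareAt s d r         ≈⟨ square-mod ⟩
    AbelianSquareAt s (d % n) r   ≈⟨ mk⇔ (square-short⇒centred (m%n<n d n) 1≤r r≤K) (λ eq → square-centred eq r≤K) ⟩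
    (d % n + r ≡ n)               ≈⟨ ≡⇔%≡0 (≤-trans 1≤r (m≤n+m r (d % n))) (+-mono-< (m%n<n d n) r<n) ⟩
    ((d % n + r) % n ≡ 0)         ≡⟨ cong (_≡ 0) (trans (%-distribˡ-+ d r n) (cong (λ c → (d % n + c) % n) (m<n⇒m%n≡m r<n))) ⟨
    ((d + r) % n ≡ 0)             ∎
    where
    open ⇔-Reasoning
    r<n : r < n
    r<n = <-≤-trans (s≤s r≤K) (m≤m+n t t)

  ¬square-half : ¬ AbelianSquareAt s d t
  ¬square-half {d} = AbelianSquareAt-once s-periodic ≤-refl once-one
    (∈-resp-↭ (window-rotate s-periodic 0 d) (subst (_∈ window s 0 n) s-K (∈-window⁺ s 0 n z≤n (<-≤-trans (n<1+n K) (m≤m+n t t)))))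

  private
    complement-short : t < r → suc r + c ≡ n → suc c < t
    complement-short {r} {c} t<r 1+r+c≡n = +-cancelˡ-< t (suc c) t (begin-strict
      t + suc c       <⟨ +-monoˡ-< (suc c) t<r ⟩
      r + suc c       ≡⟨ +-suc r c ⟩
      suc r + c       ≡⟨ 1+r+c≡n ⟩
      t + t           ∎)
      where open ≤-Reasoning

    complement : t < r → r < n → ∃[ c ] ∃[ e ] (e + c ≡ r × e + c + c ≡ n × 1 ≤ c × c ≤ K)
    complement {r} t<r r<n
      with c , 1+r+c≡n ← m≤n⇒∃[o]m+o≡n r<n
      with e , 1+c+e≡r ← m≤n⇒∃[o]m+o≡n (<⇒≤ (<-trans (complement-short t<r 1+r+c≡n) t<r)) =
      suc c , e , e+c≡r , trans (cong (_+ suc c) e+c≡r) (trans (+-suc r c) 1+r+c≡n) ,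
      s≤s z≤n , ≤-pred (complement-short t<r 1+r+c≡n)
      where
      e+c≡r : e + suc c ≡ r
      e+c≡r = trans (+-comm e (suc c)) 1+c+e≡r

  square-long⇔ : t < r → r < n → AbelianSquareAt s d r ⇔ ((d + r) % n ≡ 0)
  square-long⇔ {r} {d} t<r r<n with c , e , e+c≡r , e+c+c≡n , 1≤c , c≤K ← complement t<r r<n = begin
    AbelianSquareAt s d r            ≡⟨ cong (AbelianSquareAt s d) e+c≡r ⟨
    AbelianSquareAt s d (e + c)      ≈⟨ AbelianSquareAt-complement s-periodic e+c+c≡n ⟩
    AbelianSquareAt s (d + e) c      ≈⟨ square-short⇔ 1≤c c≤K ⟩
    ((d + e + c) % n ≡ 0)            ≡⟨ cong (λ a → a % n ≡ 0) (trans (+-assoc d e c) (cong (d +_) e+c≡r)) ⟩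
    ((d + r) % n ≡ 0)                ∎
    where open ⇔-Reasoning

  square⇔centred : 1 ≤ r → r < n → r ≢ t → AbelianSquareAt s d r ⇔ ((d + r) % n ≡ 0)
  square⇔centred {r} 1≤r r<n r≢t with r ≤? K
  ... | yes r≤K = square-short⇔ 1≤r r≤K
  ... | no  r≰K = square-long⇔ (≤∧≢⇒< (≰⇒> r≰K) (λ t≡r → r≢t (sym t≡r))) r<n

  square-below-period : r < n → AbelianSquareAt s d r ⇔ (r ≡ 0 ⊎ ((d + r) % n ≡ 0 × r ≢ t))
  square-below-period {zero}  _   = mk⇔ (λ _ → inj₁ refl) (λ _ → ↭-refl)
  square-below-period {suc r} {d} r<n with suc r ≟ t
  ... | yes refl = mk⇔ (λ sq → ⊥-elim (¬square-half sq)) λ { (inj₁ ()) ; (inj₂ (_ , t≢t)) → ⊥-elim (t≢t refl) }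
  ... | no  r≢t  = mk⇔ (λ sq → inj₂ (Equivalence.to centred sq , r≢t)) λ { (inj₁ ()) ; (inj₂ (c , _)) → Equivalence.from centred c }
    where
    centred : AbelianSquareAt s d (suc r) ⇔ ((d + suc r) % n ≡ 0)
    centred = square⇔centred (s≤s z≤n) r<n r≢t

  square-characterisation : ∀ d l → AbelianSquareAt s d l ⇔ (l % n ≡ 0 ⊎ ((d + l) % n ≡ 0 × l % n ≢ t))
  square-characterisation d l = begin
    AbelianSquareAt s d l                              ≡⟨ cong (AbelianSquareAt s d) (m≡m%n+[m/n]*n l n) ⟩
    AbelianSquareAt s d (l % n + l / n * n)            ≈⟨ AbelianSquareAt-extend (periodic-* s-periodic (l / n)) ⟩
    AbelianSquareAt s d (l % n)                        ≈⟨ square-below-period (m%n<n l n) ⟩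
    (l % n ≡ 0 ⊎ ((d + l % n) % n ≡ 0 × l % n ≢ t))   ≡⟨ cong (λ c → l % n ≡ 0 ⊎ (c ≡ 0 × l % n ≢ t)) (sym d+l%n≡) ⟩
    (l % n ≡ 0 ⊎ ((d + l) % n ≡ 0 × l % n ≢ t))       ∎
    where
    open ⇔-Reasoning
    d+l%n≡ : (d + l) % n ≡ (d + l % n) % n
    d+l%n≡ = trans (cong (λ x → (d + x) % n) (m≡m%n+[m/n]*n l n))
               (trans (cong (_% n) (sym (+-assoc d (l % n) (l / n * n)))) ([m+kn]%n≡m%n (d + l % n) (l / n) n))

  divisible⇔ : ∀ l → (4 * t) ∣ (l + l) ⇔ (l % n ≡ 0)
  divisible⇔ l = begin
    (4 * t) ∣ (l + l)   ≡⟨ cong₂ _∣_ (arith₁ t) (arith₂ l) ⟩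
    2 * n ∣ 2 * l       ≈⟨ mk⇔ (*-cancelˡ-∣ 2) (*-monoʳ-∣ 2) ⟩
    n ∣ l               ≈⟨ m%n≡0⇔n∣m l n ⟨
    (l % n ≡ 0)         ∎
    where
    open ⇔-Reasoning
    arith₁ : ∀ t → 4 * t ≡ 2 * (t + t)
    arith₁ = solve-∀
    arith₂ : ∀ l → l + l ≡ 2 * l
    arith₂ = solve-∀

  odd-multiple⇔ : ∀ l → (∃[ q ] (l + l ≡ (4 * q + 2) * t)) ⇔ (l % n ≡ t)
  odd-multiple⇔ l = mk⇔ to from
    where
    arith : ∀ q t → (4 * q + 2) * t ≡ (t + q * (t + t)) + (t + q * (t + t))
    arith = solve-∀
    to : ∃[ q ] (l + l ≡ (4 * q + 2) * t) → l % n ≡ t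
    to (q , eq) = begin
      l % n              ≡⟨ cong (_% n) (half-injective {l} {t + q * n} (trans eq (arith q t))) ⟩
      (t + q * n) % n    ≡⟨ [m+kn]%n≡m%n t q n ⟩
      t % n              ≡⟨ m<n⇒m%n≡m (m<m+n t (s≤s z≤n)) ⟩
      t                  ∎
      where open ≡-Reasoning
    from : l % n ≡ t → ∃[ q ] (l + l ≡ (4 * q + 2) * t)
    from l%n≡t = l / n , (begin
      l + l                                   ≡⟨ cong₂ _+_ l≡ l≡ ⟩
      (t + l / n * n) + (t + l / n * n)       ≡⟨ arith (l / n) t ⟨
      (4 * (l / n) + 2) * t                   ∎)
      where
      open ≡-Reasoning
      l≡ : l ≡ t + l / n * n
      l≡ = trans (m≡m%n+[m/n]*n l n) (cong (_+ l / n * n) l%n≡t)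

  zero-positions : j < n → s j ≡ zero → j ≡ 0 ⊎ j ≡ n-1
  zero-positions {zero}  _   _     = inj₁ refl
  zero-positions {suc j} j<n sj≡0 with suc j <? K
  ... | yes j<K = ⊥-elim (≡zero⇒¬Big sj≡0 (big-P (s≤s z≤n) j<K))
  ... | no  j≮K with suc j ≟ K
  ...   | yes refl = ⊥-elim (contradiction (trans (sym s-K) sj≡0) λ ())
  ...   | no  j≢K with suc j ≟ t
  ...     | yes refl = ⊥-elim (contradiction (trans (sym s-t) sj≡0) λ ())
  ...     | no  j≢t with suc j <? n-1
  ...       | yes j<n-1 = ⊥-elim (≡zero⇒¬Big sj≡0 (big-Pʳ t<j j<n-1))
    where
    t<j : t < suc j
    t<j = ≤∧≢⇒< (≤∧≢⇒< (≮⇒≥ j≮K) (λ K≡ → j≢K (sym K≡))) (λ t≡ → j≢t (sym t≡))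
  ...       | no  j≮n-1 = inj₂ (≤-antisym (≤-pred (subst (suc j <_) n≡1+n-1 j<n)) (≮⇒≥ j≮n-1))

  private
    1%n≡1 : 1 % n ≡ 1
    1%n≡1 = m<n⇒m%n≡m {n = n} (s≤s (s≤s z≤n))

    suc-% : ∀ j → suc j % n ≡ suc (j % n) % n
    suc-% j = trans (%-distribˡ-+ 1 j n) (cong (λ c → (c + j % n) % n) 1%n≡1)

  zero-pair⇔ : ∀ j → (s j ≡ zero × s (suc j) ≡ zero) ⇔ (suc j % n ≡ 0)
  zero-pair⇔ j = mk⇔ to from
    where
    to : s j ≡ zero × s (suc j) ≡ zero → suc j % n ≡ 0
    to (sj≡0 , s1+j≡0) with zero-positions (m%n<n j n) (trans (s-% j) sj≡0)
    ... | inj₂ j%n≡n-1 = trans (suc-% j) (trans (cong (λ c → suc c % n) j%n≡n-1) (trans (cong (_% n) (sym n≡1+n-1)) (n%n≡0 n)))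
    ... | inj₁ j%n≡0 with zero-positions (m%n<n (suc j) n) (trans (s-% (suc j)) s1+j≡0)
    ...   | inj₁ 1+j%n≡0    = 1+j%n≡0
    ...   | inj₂ 1+j%n≡n-1 = contradiction (trans 1≡1+j%n 1+j%n≡n-1) λ ()
      where
      1≡1+j%n : 1 ≡ suc j % n
      1≡1+j%n = sym (trans (suc-% j) (trans (cong (λ c → suc c % n) j%n≡0) 1%n≡1))
    from : suc j % n ≡ 0 → s j ≡ zero × s (suc j) ≡ zero
    from 1+j%n≡0 = trans (sym (s-% j)) (trans (cong s j%n≡n-1) s-n-1) , trans (sym (s-% (suc j))) (trans (cong s 1+j%n≡0) s-0)
      where
      j%n≡n-1 : j % n ≡ n-1
      j%n≡n-1 = trans (%-pred-≡0 {m = j} {n = n} 1+j%n≡0) (cong (_∸ 1) n≡1+n-1)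

  at-pow : ∀ m j → j < m * n → at (pow U m) j ≡ just (s j)
  at-pow m j j< = trans (cong (λ W → at W j) (pow-window m)) (at-window s 0 (m * n) j j<)

  length-pow : ∀ m → length (pow U m) ≡ m * n
  length-pow m = trans (cong length (pow-window m)) (length-window s 0 (m * n))

  factor-pow : ∀ m i L → i + L ≤ length (pow U m) → factor (pow U m) i L ≡ window s i L
  factor-pow m i L bound = trans (cong (λ W → factor W i L) (pow-window m))
                                 (factor-window s 0 i L (m * n) (subst (i + L ≤_) (length-pow m) bound))

  private
    at-pow≡zero⇔ : ∀ m j → j < length (pow U m) → (at (pow U m) j ≡ just zero) ⇔ (s j ≡ zero)
    at-pow≡zero⇔ m j j< = mk⇔ (λ eq → just-injective (trans (sym at≡) eq)) (λ eq → trans at≡ (cong just eq))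
      where
      at≡ : at (pow U m) j ≡ just (s j)
      at≡ = at-pow m j (subst (j <_) (length-pow m) j<)

  square-condition⇔ : ∀ m i len l → len ≡ l + l → 1 ≤ len → i + len ≤ length (pow U m) →
    AbelianSquareAt s i l ⇔
      ((4 * t) ∣ len
       ⊎ (at (pow U m) (i + l ∸ 1) ≡ just zero
          × at (pow U m) (i + l) ≡ just zero
          × ¬ (∃[ q ] (len ≡ (4 * q + 2) * t))))
  square-condition⇔ m i .0               zero    refl () _
  square-condition⇔ m i .(suc l + suc l) (suc l) refl _  bound = begin
    AbelianSquareAt s i (suc l)
      ≈⟨ square-characterisation i (suc l) ⟩
    (suc l % n ≡ 0 ⊎ ((i + suc l) % n ≡ 0 × suc l % n ≢ t))
      ≈⟨ ⇔-sym (divisible⇔ (suc l)) ⊎-⇔ (zeros⇔ ×-⇔ ¬-cong-⇔ (⇔-sym (odd-multiple⇔ (suc l)))) ⟩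
    ((4 * t) ∣ (suc l + suc l)
     ⊎ ((at W (i + suc l ∸ 1) ≡ just zero × at W (i + suc l) ≡ just zero)
        × ¬ (∃[ q ] (suc l + suc l ≡ (4 * q + 2) * t))))
      ≈⟨ ⇔-refl ⊎-⇔ mk⇔ assocʳ′ assocˡ′ ⟩
    ((4 * t) ∣ (suc l + suc l)
     ⊎ (at W (i + suc l ∸ 1) ≡ just zero
        × at W (i + suc l) ≡ just zero
        × ¬ (∃[ q ] (suc l + suc l ≡ (4 * q + 2) * t)))) ∎
    where
    open ⇔-Reasoning
    W : Str
    W = pow U m
    i+l<∣W∣ : suc (i + l) < length W
    i+l<∣W∣ = <-≤-trans (subst (_< i + (suc l + suc l)) (+-suc i l) (+-monoʳ-< i (m<m+n (suc l) (s≤s z≤n)))) bound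
    zeros⇔ : ((i + suc l) % n ≡ 0) ⇔ (at W (i + suc l ∸ 1) ≡ just zero × at W (i + suc l) ≡ just zero)
    zeros⇔ = begin
      ((i + suc l) % n ≡ 0)                                    ≡⟨ cong (λ c → c % n ≡ 0) (+-suc i l) ⟩
      (suc (i + l) % n ≡ 0)                                    ≈⟨ zero-pair⇔ (i + l) ⟨
      (s (i + l) ≡ zero × s (suc (i + l)) ≡ zero)             ≈⟨ at-pow≡zero⇔ m (i + l) (<-trans (n<1+n _) i+l<∣W∣)
                                                                  ×-⇔ at-pow≡zero⇔ m (suc (i + l)) i+l<∣W∣ ⟨
      (at W (i + l) ≡ just zero × at W (suc (i + l)) ≡ just zero)
        ≡⟨ cong (λ c → at W (c ∸ 1) ≡ just zero × at W c ≡ just zero) (+-suc i l) ⟨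
      (at W (i + suc l ∸ 1) ≡ just zero × at W (i + suc l) ≡ just zero) ∎

lemma26 : (t m : ℕ) → 2 ≤ t → 1 ≤ m →
    (P : List Letter) → length P + 2 ≡ t →
    All (λ c → 3 ≤ toℕ c) P →
    ¬ HasAbelianSquareFactor P →
    (i len : ℕ) → 1 ≤ len → i + len ≤ length (pow (U2t P) m) →
    IsAbelianSquare (factor (pow (U2t P) m) i len)
      ⇔ (∃[ ℓ ] (len ≡ ℓ + ℓ
          × ((4 * t) ∣ len
             ⊎ (at (pow (U2t P) m) (i + ℓ ∸ 1) ≡ just zero
                × at (pow (U2t P) m) (i + ℓ) ≡ just zero
                × ¬ (∃[ q ] (len ≡ (4 * q + 2) * t))))))
lemma26 t m _ _ P |P|+2≡t P-big P-square-free i len 1≤len bound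
  with refl ← trans (+-comm 2 (length P)) |P|+2≡t = begin
  IsAbelianSquare (factor (pow U m) i len)          ≡⟨ cong IsAbelianSquare (factor-pow m i len bound) ⟩
  IsAbelianSquare (window s i len)                  ≈⟨ IsAbelianSquare-window⇔ s i len 1≤len ⟩
  (∃[ ℓ ] (len ≡ ℓ + ℓ × AbelianSquareAt s i ℓ))    ≈⟨ ∃-×-cong⇔ (λ ℓ len≡ → square-condition⇔ m i len ℓ len≡ 1≤len bound) ⟩
  _                                                 ∎
  where
  open Periodic-U2t P P-big P-square-free
  open ⇔-Reasoning
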